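{- Let $S_1=T_1^{[p_1]}$ and $S_2=T_2^{[p_2]}$ be two thick lines in the Bruhat–Tits tree of $\mathrm{PSL}_2(k)$ with stems $T_1,T_2$ and depths $p_1,p_2$, whose stems intersect as follows: $T_1\cap T_2$ is a path of length $e\ge0$ with endpoints $y,z$; $T_1$ consists of $T_1\cap T_2$ together with a segment of length $a$ attached at $y$ and a segment of length $b$ attached at $z$; $T_2$ consists of $T_1\cap T_2$ together with a segment of length $c$ attached at $y$ and a segment of length $d$ attached at $z$ (the lengths $a,b,c,d$ may be infinite, a ray having length $\infty/2$). Then $S_3=S_1\cap S_2$ is a thick line with depth $p_3=\min\{p_1,p_2\}$ and stem length $$l_3=\begin{cases} e+\min\{a,p_2-p_1\}+\min\{b,p_2-p_1\} & \text{if } p_1\le p_2,\\ e+\min\{c,p_1-p_2\}+\min\{d,p_1-p_2\} & \text{if } p_2\le p_1.\end{cases}$$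
   Context: Let $k$ be a non-archimedean local field with ring of integers $\mathcal{O}$, uniformizer $\pi$, and residue field of cardinality $q$. The Bruhat–Tits tree of $\mathrm{PSL}_2(k)$ is the $(q+1)$-regular tree whose vertices are the maximal $\mathcal{O}$-orders of $\mathbb{M}_2(k)$ (equivalently, homothety classes of $\mathcal{O}$-lattices $\Lambda\subset k^2$), two classes $[\Lambda],[\Lambda']$ being adjacent iff representatives can be chosen with $\pi\Lambda\subsetneq\Lambda'\subsetneq\Lambda$. $\delta$ is the path distance, $B[x;r]$ the closed ball, and $S^{[r]}=\bigcup_{x\in S}B[x;r]$. A path is a finite geodesic, a geodesic ray, or a bi-infinite geodesic. A $p$-thick line with stem $T$ is $T^{[p]}$ for a path $T$ and integer $p\ge0$; its depth is $p$ and its stem length is the length of $T$ ($\infty/2$ for a ray, $\infty$ for a bi-infinite geodesic). Conventions: $\min(\alpha,\infty/2)=\alpha$, $\alpha+\infty/2=\infty/2$, $\infty/2+\infty/2=\infty$. -}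

module Defs where

open import Data.Nat using (ℕ; zero; suc; _+_; _≤_; _⊓_; _∸_; _^_)
open import Data.Nat.Primality using (Prime)
open import Data.Integer as ℤ using (ℤ; +_; -_; ∣_∣)
open import Data.Fin using (Fin)
open import Data.Fin.Properties using () renaming (_≟_ to _≟ᶠ_)
open import Data.List using (List; []; _∷_)
open import Data.Bool using (Bool; true; false; not; _∧_; T)
open import Data.Product using (Σ; _×_; _,_; proj₁)
open import Data.Sum using (_⊎_)
open import Relation.Nullary.Decidable using (⌊_⌋)
open import Relation.Binary.PropositionalEquality using (_≡_)
open import Function.Bundles using (_⇔_)

IsPrimePower : ℕ → Set
IsPrimePower q = Σ ℕ λ p → Σ ℕ λ n → Prime p × q ≡ p ^ suc n

-- The (q+1)-regular tree (the Bruhat–Tits tree of PSL₂(k), |residue field| = q),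
-- modelled as reduced words over an alphabet of q+1 letters
-- (no two consecutive letters equal); w is adjacent to a ∷ w.

Word : ℕ → Set
Word q = List (Fin (suc q))

reduced : ∀ {q} → Word q → Bool
reduced []            = true
reduced (x ∷ [])      = true
reduced (x ∷ y ∷ w)   = not ⌊ x ≟ᶠ y ⌋ ∧ reduced (y ∷ w)

Vertex : ℕ → Set
Vertex q = Σ (Word q) λ w → T (reduced w)

Adj : ∀ {q} → Vertex q → Vertex q → Set
Adj {q} x y =
  (Σ (Fin (suc q)) λ a → proj₁ y ≡ a ∷ proj₁ x) ⊎
  (Σ (Fin (suc q)) λ a → proj₁ x ≡ a ∷ proj₁ y)

data Walk {q : ℕ} : Vertex q → Vertex q → ℕ → Set where
  []  : ∀ {x} → Walk x x 0
  _∷_ : ∀ {x y z n} → Adj x y → Walk y z n → Walk x z (suc n)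

Dist : ∀ {q} → Vertex q → Vertex q → ℕ → Set
Dist x y n = Walk x y n × (∀ m → Walk x y m → n ≤ m)

InBall : ∀ {q} → Vertex q → ℕ → Vertex q → Set
InBall x r v = Σ ℕ λ n → Dist x v n × n ≤ r

-- A path is a map γ : ℤ → Vertex restricted to an interval
-- [-left, right] of ℤ, where each end is finite or infinite,
-- and which is isometric: δ(γ i, γ j) = |i - j|.

data Ext : Set where
  fin : ℕ → Ext
  inf : Ext

_+ᴱ_ : ℕ → Ext → Ext
e +ᴱ fin n = fin (e + n)
e +ᴱ inf   = inf

LeftOK : Ext → ℤ → Set
LeftOK (fin n) i = - (+ n) ℤ.≤ i
LeftOK inf     i = Data.Unit.⊤
  where import Data.Unit

RightOK : Ext → ℤ → Set
RightOK (fin n) i = i ℤ.≤ + n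
RightOK inf     i = Data.Unit.⊤
  where import Data.Unit

record Path (q : ℕ) : Set where
  field
    γ     : ℤ → Vertex q
    left  : Ext
    right : Ext
    geodesic : ∀ i j → LeftOK left i → RightOK right i →
                       LeftOK left j → RightOK right j →
                       Dist (γ i) (γ j) ∣ i ℤ.- j ∣

open Path public

InDom : ∀ {q} → Path q → ℤ → Set
InDom T i = LeftOK (left T) i × RightOK (right T) i

OnPath : ∀ {q} → Path q → Vertex q → Set
OnPath T v = Σ ℤ λ i → InDom T i × γ T i ≡ v

-- lengths: finite, ∞/2 (ray), ∞ (bi-infinite geodesic)
data Len : Set where
  fin  : ℕ → Len
  half∞ : Len
  ∞    : Len

length : ∀ {q} → Path q → Len
length T with left T | right T
... | fin m | fin n = fin (m + n)
... | fin _ | inf   = half∞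
... | inf   | fin _ = half∞
... | inf   | inf   = ∞

Thick : ∀ {q} → Path q → ℕ → Vertex q → Set
Thick T p v = Σ ℤ λ i → InDom T i × InBall (γ T i) p v

IsThickLine : ∀ {q} → (Vertex q → Set) → ℕ → Len → Set
IsThickLine {q} S p l =
  Σ (Path q) λ T → length T ≡ l × (∀ v → S v ⇔ Thick T p v)

-- min(α, k) for α ∈ ℕ ∪ {∞/2} and k ∈ ℕ, with min(∞/2, k) = k
minE : Ext → ℕ → ℕ
minE (fin n) k = n ⊓ k
minE inf     k = k

{-# OPTIONS --safe #-}
module Submission where

-- Reversing the reduced words identifies the tree with a prefix tree, so d x y = |x| + |y| - 2 c x y
-- with c x y the length of the common suffix. The ultrametric inequality for c yields the triangle
-- and four-point inequalities for d, and d x y ≡ |x| + |y| (mod 2) makes the tree bipartite.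
-- In such a metric a geodesic ray r leaving T₂ at r 0 satisfies d (r n) u = n + d (r 0) u for all
-- u on T₂. Let p₁ ≤ p₂ and k = p₂ - p₁. By the triangle inequality, the p₁-ball around a point of T₁
-- at most k beyond y or z lies within p₂ of T₂; if v is within p₁ of r n (n > k) and within p₂ of T₂,
-- the four-point condition puts v within p₁ of r k. So the intersection is the p₁-thickening of T₁
-- cut k beyond y and z; the case p₂ ≤ p₁ is symmetric.

open import Defs
open import Data.Nat using (ℕ; zero; suc; _+_; _≤_; _<_; _⊓_; _∸_; z≤n; s≤s; ⌊_/2⌋; ⌈_/2⌉)
open import Data.Nat.Properties
open import Data.Nat.Tactic.RingSolver using (solve-∀)
open import Data.List using (List; []; _∷_; _++_; [_]; take; drop; reverse)
import Data.List as List
open import Data.List.Properties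
  using (++-identityʳ; length-++; length-drop; length-reverse; take++drop≡id; reverse-++; reverse-involutive; unfold-reverse)
open import Data.Fin.Properties using () renaming (_≟_ to _≟ᶠ_)
open import Data.Bool using (T)
open import Data.Bool.Properties using (T-∧; T-irrelevant)
open import Data.Sum using (swap)
open import Function.Bundles using (Equivalence; _⇔_; mk⇔)
import Function.Properties.Equivalence as ⇔
open import Data.Integer as ℤ using (ℤ; -[1+_]; ∣_∣) renaming (_≤_ to _≤ℤ_)
import Data.Integer.Properties as ℤ
import Data.Integer.Tactic.RingSolver as ℤ-Solver
open import Data.Unit using (⊤; tt)
open import Data.Product using (Σ; _×_; _,_; proj₁; proj₂) renaming (swap to ×-swap)
open import Data.Sum using (_⊎_; inj₁; inj₂)
open import Data.Empty using (⊥-elim)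
open import Relation.Nullary using (yes; no)
open import Relation.Binary.Definitions using (DecidableEquality; tri<; tri≈; tri>)
open import Relation.Binary.PropositionalEquality hiding ([_])
open import Function using (_∘_)
open import Algebra.Properties.CommutativeSemigroup +-commutativeSemigroup using (interchange)

module CommonPrefix {A : Set} (_≟_ : DecidableEquality A) where

  lcp : List A → List A → ℕ
  lcp []      _       = 0
  lcp (_ ∷ _) []      = 0
  lcp (x ∷ u) (y ∷ v) with x ≟ y
  ... | yes _ = suc (lcp u v)
  ... | no  _ = 0

  lcp-∷-≡ : ∀ x u v → lcp (x ∷ u) (x ∷ v) ≡ suc (lcp u v)
  lcp-∷-≡ x u v with x ≟ x
  ... | yes _  = refl
  ... | no x≢x = ⊥-elim (x≢x refl)

  lcp-∷-≢ : ∀ {x y} u v → x ≢ y → lcp (x ∷ u) (y ∷ v) ≡ 0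
  lcp-∷-≢ {x} {y} u v x≢y with x ≟ y
  ... | yes x≡y = ⊥-elim (x≢y x≡y)
  ... | no  _   = refl

  lcp-comm : ∀ u v → lcp u v ≡ lcp v u
  lcp-comm []      []      = refl
  lcp-comm []      (_ ∷ _) = refl
  lcp-comm (_ ∷ _) []      = refl
  lcp-comm (x ∷ u) (y ∷ v) with x ≟ y
  ... | yes refl = trans (cong suc (lcp-comm u v)) (sym (lcp-∷-≡ x v u))
  ... | no  x≢y  = sym (lcp-∷-≢ v u (x≢y ∘ sym))

  lcp≤length : ∀ u v → lcp u v ≤ List.length u
  lcp≤length []      _       = z≤n
  lcp≤length (_ ∷ _) []      = z≤n
  lcp≤length (x ∷ u) (y ∷ v) with x ≟ y
  ... | yes _ = s≤s (lcp≤length u v)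
  ... | no  _ = z≤n

  lcp-++ : ∀ u v → lcp u (u ++ v) ≡ List.length u
  lcp-++ []      v = refl
  lcp-++ (x ∷ u) v = trans (lcp-∷-≡ x u (u ++ v)) (cong suc (lcp-++ u v))

  lcp-refl : ∀ u → lcp u u ≡ List.length u
  lcp-refl u = trans (cong (lcp u) (sym (++-identityʳ u))) (lcp-++ u [])

  take-lcp : ∀ u v → take (lcp u v) u ≡ take (lcp u v) v
  take-lcp []      _       = refl
  take-lcp (_ ∷ _) []      = refl
  take-lcp (x ∷ u) (y ∷ v) with x ≟ y
  ... | yes refl = cong (x ∷_) (take-lcp u v)
  ... | no  _    = refl

  lcp-ultrametric : ∀ u v w → lcp u v ≤ lcp u w ⊎ lcp v w ≤ lcp u w
  lcp-ultrametric []      _       _       = inj₁ z≤n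
  lcp-ultrametric (_ ∷ _) []      _       = inj₁ z≤n
  lcp-ultrametric (_ ∷ _) (_ ∷ _) []      = inj₂ z≤n
  lcp-ultrametric (x ∷ u) (y ∷ v) (z ∷ w) with x ≟ y
  ... | no _ = inj₁ z≤n
  ... | yes refl with x ≟ z
  ...   | no _ = inj₂ z≤n
  ...   | yes refl with lcp-ultrametric u v w
  ...     | inj₁ uv≤uw = inj₁ (s≤s uv≤uw)
  ...     | inj₂ vw≤uw = inj₂ (s≤s vw≤uw)

odd≢even : ∀ m n → suc (m + m) ≢ n + n
odd≢even m n eq = 1+n≢n (trans 1+m≡n (sym m≡n))
  where
  m≡n : m ≡ n
  m≡n = trans (n≡⌈n+n/2⌉ m) (trans (cong ⌊_/2⌋ eq) (sym (n≡⌊n+n/2⌋ n)))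
  1+m≡n : suc m ≡ n
  1+m≡n = trans (cong suc (n≡⌊n+n/2⌋ m)) (trans (cong ⌈_/2⌉ eq) (sym (n≡⌈n+n/2⌉ n)))

≤-by-complements : ∀ {a b m n} → a + m ≡ b + n → n ≤ m → a ≤ b
≤-by-complements {a} {b} {m} {n} eq n≤m =
  +-cancelʳ-≤ n a b (≤-trans (+-monoʳ-≤ a n≤m) (≤-reflexive eq))

m+n≤n⇒m≡0 : ∀ {m n} → m + n ≤ n → m ≡ 0
m+n≤n⇒m≡0 {m} {n} m+n≤n = n≤0⇒n≡0 (+-cancelʳ-≤ n m 0 m+n≤n)

module UltrametricFourPoint {X : Set} (c : X → X → ℕ)
  (c-comm : ∀ x y → c x y ≡ c y x)
  (c-ultrametric : ∀ x y z → c x y ≤ c x z ⊎ c y z ≤ c x z) where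

  private
    four-point-< : ∀ x y z w → c x y < c x z →
                   c x z + c y w ≤ c x y + c z w ⊎ c x w + c y z ≤ c x y + c z w
    four-point-< x y z w xy<xz with ≤-total (c x w) (c x z)
    ... | inj₁ xw≤xz = inj₂ (≤-trans (+-mono-≤ xw≤zw yz≤xy) (≤-reflexive (+-comm (c z w) (c x y))))
      where
      yz≤xy : c y z ≤ c x y
      yz≤xy with c-ultrametric x z y
      ... | inj₁ xz≤xy = ⊥-elim (<⇒≱ xy<xz xz≤xy)
      ... | inj₂ zy≤xy = subst (_≤ c x y) (c-comm z y) zy≤xy
      xw≤zw : c x w ≤ c z w
      xw≤zw with c-ultrametric z x w
      ... | inj₁ zx≤zw = ≤-trans xw≤xz (subst (_≤ c z w) (c-comm z x) zx≤zw)
      ... | inj₂ xw≤zw = xw≤zw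
    ... | inj₂ xz≤xw = inj₁ (≤-trans (+-mono-≤ xz≤zw yw≤xy) (≤-reflexive (+-comm (c z w) (c x y))))
      where
      xz≤zw : c x z ≤ c z w
      xz≤zw with c-ultrametric z x w
      ... | inj₁ zx≤zw = subst (_≤ c z w) (c-comm z x) zx≤zw
      ... | inj₂ xw≤zw = ≤-trans xz≤xw xw≤zw
      yw≤xy : c y w ≤ c x y
      yw≤xy with c-ultrametric x w y
      ... | inj₁ xw≤xy = ⊥-elim (<⇒≱ (<-≤-trans xy<xz xz≤xw) xw≤xy)
      ... | inj₂ wy≤xy = subst (_≤ c x y) (c-comm w y) wy≤xy

  c-four-point : ∀ x y z w → c x z + c y w ≤ c x y + c z w ⊎ c x w + c y z ≤ c x y + c z w
  c-four-point x y z w with c x y <? c x z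
  ... | yes xy<xz = four-point-< x y z w xy<xz
  ... | no  xy≮xz with c y w ≤? c z w
  ...   | yes yw≤zw = inj₁ (+-mono-≤ (≮⇒≥ xy≮xz) yw≤zw)
  ...   | no  yw≰zw with four-point-< w z y x (subst₂ _<_ (c-comm z w) (c-comm y w) (≰⇒> yw≰zw))
  ...     | inj₁ le = inj₁ (subst₂ _≤_ (trans (cong₂ _+_ (c-comm w y) (c-comm z x)) (+-comm (c y w) (c x z)))
                                        (trans (cong₂ _+_ (c-comm w z) (c-comm y x)) (+-comm (c z w) (c x y))) le)
  ...     | inj₂ le = inj₂ (subst₂ _≤_ (cong₂ _+_ (c-comm w x) (c-comm z y))
                                        (trans (cong₂ _+_ (c-comm w z) (c-comm y x)) (+-comm (c z w) (c x y))) le)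

module RootedTreeMetric {X : Set} (height : X → ℕ) (c : X → X → ℕ)
  (c-comm : ∀ x y → c x y ≡ c y x)
  (c-ultrametric : ∀ x y z → c x y ≤ c x z ⊎ c y z ≤ c x z)
  (c≤height : ∀ x y → c x y ≤ height x)
  (c-refl : ∀ x → c x x ≡ height x) where

  open UltrametricFourPoint c c-comm c-ultrametric

  c≤heightʳ : ∀ x y → c x y ≤ height y
  c≤heightʳ x y = subst (_≤ height y) (c-comm y x) (c≤height y x)

  -- Opaque so that unification never unfolds d into truncated subtractions.
  opaque
    d : X → X → ℕ
    d x y = (height x ∸ c x y) + (height y ∸ c x y)

    d-definition : ∀ x y → d x y ≡ (height x ∸ c x y) + (height y ∸ c x y)
    d-definition x y = refl

    d+2c≡height+height : ∀ x y → d x y + (c x y + c x y) ≡ height x + height y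
    d+2c≡height+height x y =
      trans (interchange (height x ∸ c x y) (height y ∸ c x y) (c x y) (c x y))
            (cong₂ _+_ (m∸n+n≡m (c≤height x y)) (m∸n+n≡m (c≤heightʳ x y)))

    d-sym : ∀ x y → d x y ≡ d y x
    d-sym x y rewrite c-comm x y = +-comm (height x ∸ c y x) (height y ∸ c y x)

    d-refl : ∀ x → d x x ≡ 0
    d-refl x rewrite c-refl x | n∸n≡0 (height x) = refl

    d-child : ∀ {x y} → c x y ≡ height x → height y ≡ suc (height x) → d x y ≡ 1
    d-child {x} {y} cxy≡hx hy≡1+hx rewrite cxy≡hx | hy≡1+hx | n∸n≡0 (height x) = m+n∸n≡m 1 (height x)

  private
    pair-sum-identity : ∀ x y z w →
      (d x y + d z w) + ((c x y + c z w) + (c x y + c z w)) ≡ (height x + height y) + (height z + height w)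
    pair-sum-identity x y z w = begin
      (d x y + d z w) + ((c x y + c z w) + (c x y + c z w))
        ≡⟨ cong ((d x y + d z w) +_) (interchange (c x y) (c z w) (c x y) (c z w)) ⟩
      (d x y + d z w) + ((c x y + c x y) + (c z w + c z w))
        ≡⟨ interchange (d x y) (d z w) _ _ ⟩
      (d x y + (c x y + c x y)) + (d z w + (c z w + c z w))
        ≡⟨ cong₂ _+_ (d+2c≡height+height x y) (d+2c≡height+height z w) ⟩
      (height x + height y) + (height z + height w) ∎
      where open ≡-Reasoning

    pair-sums-≤ : ∀ x y z w x′ y′ z′ w′ →
      (height x + height y) + (height z + height w) ≡ (height x′ + height y′) + (height z′ + height w′) →
      c x′ y′ + c z′ w′ ≤ c x y + c z w → d x y + d z w ≤ d x′ y′ + d z′ w′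
    pair-sums-≤ x y z w x′ y′ z′ w′ heights c≤c = ≤-by-complements
      (trans (pair-sum-identity x y z w) (trans heights (sym (pair-sum-identity x′ y′ z′ w′))))
      (+-mono-≤ c≤c c≤c)

  d-triangle : ∀ x y z → d x z ≤ d x y + d y z
  d-triangle x y z = subst₂ _≤_ (trans (cong (d x z +_) (d-refl y)) (+-identityʳ (d x z)))
                                (cong (d x y +_) (d-sym z y))
    (pair-sums-≤ x z y y x y z y (interchange (height x) (height z) (height y) (height y))
                 (subst (λ h → c x y + c z y ≤ c x z + h) (sym (c-refl y)) c≤c))
    where
    c≤c : c x y + c z y ≤ c x z + height y
    c≤c with c-ultrametric x y z
    ... | inj₁ xy≤xz = +-mono-≤ xy≤xz (c≤heightʳ z y)
    ... | inj₂ yz≤xz = subst (_≤ c x z + height y) (+-comm (c z y) (c x y))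
                             (+-mono-≤ (subst (_≤ c x z) (c-comm y z) yz≤xz) (c≤heightʳ x y))

  d-four-point : ∀ x y z w → d x y + d z w ≤ d x z + d y w ⊎ d x y + d z w ≤ d x w + d y z
  d-four-point x y z w with c-four-point x y z w
  ... | inj₁ c≤c = inj₁ (pair-sums-≤ x y z w x z y w (interchange (height x) (height y) (height z) (height w)) c≤c)
  ... | inj₂ c≤c = inj₂ (pair-sums-≤ x y z w x w y z
          (trans (cong ((height x + height y) +_) (+-comm (height z) (height w)))
                 (interchange (height x) (height y) (height w) (height z))) c≤c)

  d-parity : ∀ {x y u} → d x y ≡ 1 → d x u ≢ d y u
  d-parity {x} {y} {u} dxy≡1 dxu≡dyu =
    odd≢even (c x y + height u) (d x u + c x u + c y u) (begin
      suc ((c x y + height u) + (c x y + height u))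
        ≡⟨ cong suc (interchange (c x y) (height u) (c x y) (height u)) ⟩
      suc (c x y + c x y) + (height u + height u)
        ≡⟨ cong (λ t → t + (c x y + c x y) + (height u + height u)) (sym dxy≡1) ⟩
      (d x y + (c x y + c x y)) + (height u + height u)
        ≡⟨ cong (_+ (height u + height u)) (d+2c≡height+height x y) ⟩
      (height x + height y) + (height u + height u)
        ≡⟨ interchange (height x) (height y) (height u) (height u) ⟩
      (height x + height u) + (height y + height u)
        ≡⟨ cong₂ _+_ (sym (d+2c≡height+height x u)) (sym (d+2c≡height+height y u)) ⟩
      (d x u + (c x u + c x u)) + (d y u + (c y u + c y u))
        ≡⟨ cong (λ t → (d x u + (c x u + c x u)) + (t + (c y u + c y u))) (sym dxu≡dyu) ⟩
      (d x u + (c x u + c x u)) + (d x u + (c y u + c y u))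
        ≡⟨ regroup (d x u) (c x u) (c y u) ⟩
      (d x u + c x u + c y u) + (d x u + c x u + c y u) ∎)
    where
    open ≡-Reasoning
    regroup : ∀ t a b → (t + (a + a)) + (t + (b + b)) ≡ (t + a + b) + (t + a + b)
    regroup = solve-∀

module ReducedWordTree (q : ℕ) where

  open CommonPrefix (_≟ᶠ_ {suc q})

  reduced-∷⁻ : ∀ a (w : Word q) → T (reduced (a ∷ w)) → T (reduced w)
  reduced-∷⁻ a []      _ = _
  reduced-∷⁻ a (b ∷ w) r = proj₂ (Equivalence.to T-∧ r)

  reduced-++⁻ʳ : ∀ (u w : Word q) → T (reduced (u ++ w)) → T (reduced w)
  reduced-++⁻ʳ []      w r = r
  reduced-++⁻ʳ (a ∷ u) w r = reduced-++⁻ʳ u w (reduced-∷⁻ a (u ++ w) r)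

  vertex-≡ : {x y : Vertex q} → proj₁ x ≡ proj₁ y → x ≡ y
  vertex-≡ {w , r} {.w , r′} refl = cong (w ,_) (T-irrelevant r r′)

  rev : Vertex q → Word q
  rev x = reverse (proj₁ x)

  open RootedTreeMetric (List.length ∘ rev) (λ x y → lcp (rev x) (rev y))
    (λ x y → lcp-comm (rev x) (rev y)) (λ x y z → lcp-ultrametric (rev x) (rev y) (rev z))
    (λ x y → lcp≤length (rev x) (rev y)) (λ x → lcp-refl (rev x)) public

  Adj-sym : {x y : Vertex q} → Adj x y → Adj y x
  Adj-sym = swap

  Adj⇒d≡1 : {x y : Vertex q} → Adj x y → d x y ≡ 1
  Adj⇒d≡1 {x} {y} (inj₁ (a , y≡a∷x)) =
    d-child (trans (cong (lcp (rev x)) rev-y) (lcp-++ (rev x) [ a ]))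
            (trans (cong List.length rev-y) (trans (length-++ (rev x)) (+-comm _ 1)))
    where
    rev-y : rev y ≡ rev x ++ [ a ]
    rev-y = trans (cong reverse y≡a∷x) (unfold-reverse a (proj₁ x))
  Adj⇒d≡1 {x} {y} (inj₂ adj) = trans (d-sym x y) (Adj⇒d≡1 {y} {x} (inj₁ adj))

  walk-∷ʳ : ∀ {x y z : Vertex q} {n} → Walk x y n → Adj y z → Walk x z (suc n)
  walk-∷ʳ []        adj = adj ∷ []
  walk-∷ʳ (a ∷ w)   adj = a ∷ walk-∷ʳ w adj

  walk-++ : ∀ {x y z : Vertex q} {m n} → Walk x y m → Walk y z n → Walk x z (m + n)
  walk-++ []      w′ = w′
  walk-++ (a ∷ w) w′ = a ∷ walk-++ w w′

  walk-reverse : ∀ {x y : Vertex q} {n} → Walk x y n → Walk y x n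
  walk-reverse []      = []
  walk-reverse (_∷_ {x} {y} a w) = walk-∷ʳ (walk-reverse w) (Adj-sym {x} {y} a)

  walk-to-suffix : ∀ (u w : Word q) (r : T (reduced (u ++ w))) →
                   Walk (u ++ w , r) (w , reduced-++⁻ʳ u w r) (List.length u)
  walk-to-suffix []      w r = []
  walk-to-suffix (a ∷ u) w r = inj₂ (a , refl) ∷ walk-to-suffix u w (reduced-∷⁻ a (u ++ w) r)

  walk-to-suffixᵛ : ∀ (x : Vertex q) (u w : Word q) → proj₁ x ≡ u ++ w → (r : T (reduced w)) →
                    Walk x (w , r) (List.length u)
  walk-to-suffixᵛ (.(u ++ w) , rx) u w refl r =
    subst (λ v → Walk (u ++ w , rx) v (List.length u)) (vertex-≡ refl) (walk-to-suffix u w rx)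

  split-suffix : ∀ (w : Word q) n → w ≡ reverse (drop n (reverse w)) ++ reverse (take n (reverse w))
  split-suffix w n = begin
    w                                             ≡⟨ reverse-involutive w ⟨
    reverse (reverse w)                           ≡⟨ cong reverse (take++drop≡id n (reverse w)) ⟨
    reverse (take n (reverse w) ++ drop n (reverse w)) ≡⟨ reverse-++ (take n (reverse w)) (drop n (reverse w)) ⟩
    reverse (drop n (reverse w)) ++ reverse (take n (reverse w)) ∎
    where open ≡-Reasoning

  -- Both words end in the common suffix of length c x y; walk down to it and back up.
  geodesic-walk : ∀ x y → Walk x y (d x y)
  geodesic-walk x y = subst (Walk x y) (trans (cong₂ _+_ (length-prefix x) (length-prefix y)) (sym (d-definition x y)))
    (walk-++ (walk-to-suffixᵛ x _ s (split-suffix (proj₁ x) k) rs)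
             (walk-reverse (walk-to-suffixᵛ y _ s y≡prefix++s rs)))
    where
    k = lcp (rev x) (rev y)
    s = reverse (take k (rev x))
    prefix : Vertex q → Word q
    prefix v = reverse (drop k (rev v))
    length-prefix : ∀ v → List.length (prefix v) ≡ List.length (rev v) ∸ k
    length-prefix v = trans (length-reverse (drop k (rev v))) (length-drop k (rev v))
    y≡prefix++s : proj₁ y ≡ prefix y ++ s
    y≡prefix++s = trans (split-suffix (proj₁ y) k) (cong (λ t → prefix y ++ reverse t) (sym (take-lcp (rev x) (rev y))))
    rs : T (reduced s)
    rs = reduced-++⁻ʳ (prefix x) s (subst (T ∘ reduced) (split-suffix (proj₁ x) k) (proj₂ x))

  d≤walk-length : ∀ {x y : Vertex q} {n} → Walk x y n → d x y ≤ n
  d≤walk-length {x} []                      = ≤-reflexive (d-refl x)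
  d≤walk-length {x} {z} (_∷_ {y = y} adj w) =
    ≤-trans (d-triangle x y z) (+-mono-≤ (≤-reflexive (Adj⇒d≡1 {x} {y} adj)) (d≤walk-length w))

  Dist-d : ∀ x y → Dist x y (d x y)
  Dist-d x y = geodesic-walk x y , λ _ → d≤walk-length

  Dist⇒≡d : ∀ {x y : Vertex q} {n} → Dist x y n → n ≡ d x y
  Dist⇒≡d {x} {y} (walk , minimal) = ≤-antisym (minimal (d x y) (geodesic-walk x y)) (d≤walk-length walk)

  d≡0⇒≡ : ∀ {x y} → d x y ≡ 0 → x ≡ y
  d≡0⇒≡ {x} {y} dxy≡0 with subst (Walk x y) dxy≡0 (geodesic-walk x y)
  ... | [] = refl

  InBall⇒d≤ : ∀ {x r v} → InBall {q} x r v → d x v ≤ r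
  InBall⇒d≤ (n , dist , n≤r) = subst (_≤ _) (Dist⇒≡d dist) n≤r

  d≤⇒InBall : ∀ {x r v} → d x v ≤ r → InBall {q} x r v
  d≤⇒InBall {x} {r} {v} dxv≤r = d x v , Dist-d x v , dxv≤r

module TreeGeometry {V : Set} (d : V → V → ℕ)
  (d-sym : ∀ x y → d x y ≡ d y x)
  (d≡0⇒≡ : ∀ {x y} → d x y ≡ 0 → x ≡ y)
  (d-triangle : ∀ x y z → d x z ≤ d x y + d y z)
  (d-four-point : ∀ x y z w → d x y + d z w ≤ d x z + d y w ⊎ d x y + d z w ≤ d x w + d y z)
  (d-parity : ∀ {x y u} → d x y ≡ 1 → d x u ≢ d y u) where

  between-unique : ∀ {y z g g′ m n} → d g y ≡ m → d g z ≡ n → d g′ y ≡ m → d g′ z ≡ n →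
                   d y z ≡ m + n → g ≡ g′
  between-unique {y} {z} {g} {g′} {m} {n} gy gz g′y g′z yz with d-four-point g g′ y z
  ... | inj₁ le = d≡0⇒≡ (m+n≤n⇒m≡0 (subst₂ (λ s t → d g g′ + s ≤ t) yz (cong₂ _+_ gy g′z) le))
  ... | inj₂ le = d≡0⇒≡ (m+n≤n⇒m≡0 (subst₂ (λ s t → d g g′ + s ≤ t) yz (trans (cong₂ _+_ gz g′y) (+-comm n m)) le))

  step-away : ∀ {y g u} → d y g ≡ 1 → suc (d g u) ≢ d y u → d g u ≡ suc (d y u)
  step-away {y} {g} {u} yg≡1 not-toward with <-cmp (d g u) (d y u)
  ... | tri< gu<yu _ _ = ⊥-elim (not-toward (≤-antisym gu<yu yu≤1+gu))
    where
    yu≤1+gu : d y u ≤ suc (d g u)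
    yu≤1+gu = subst (λ t → d y u ≤ t + d g u) yg≡1 (d-triangle y g u)
  ... | tri≈ _ gu≡yu _ = ⊥-elim (d-parity yg≡1 (sym gu≡yu))
  ... | tri> _ _ yu<gu = ≤-antisym gu≤1+yu yu<gu
    where
    gu≤1+yu : d g u ≤ suc (d y u)
    gu≤1+yu = subst (λ t → d g u ≤ t + d y u) (trans (d-sym g y) yg≡1) (d-triangle g y u)

  -- g is the first step from y towards x but a step away from u, so y lies between x and u.
  extend-geodesic : ∀ {x y g u} → d y g ≡ 1 → d x y ≡ suc (d x g) → d g u ≡ suc (d y u) →
                    d x u ≡ d x y + d y u
  extend-geodesic {x} {y} {g} {u} yg≡1 xy≡1+xg gu≡1+yu with d-four-point x y g u
  ... | inj₁ le = ⊥-elim (<⇒≱ (+-mono-< (subst (d x g <_) (sym xy≡1+xg) ≤-refl) (n<1+n (d y u)))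
                                (subst (λ t → d x y + t ≤ d x g + d y u) gu≡1+yu le))
  ... | inj₂ le = ≤-antisym (d-triangle x y u) (+-cancelʳ-≤ 1 (d x y + d y u) (d x u)
                    (subst₂ _≤_ (trans (trans (cong (d x y +_) gu≡1+yu) (+-suc (d x y) (d y u))) (+-comm 1 _))
                                (cong (d x u +_) yg≡1) le))

  ball-∩-between : ∀ {w x u v p} → d x u ≡ d x w + d w u → d x v ≤ p → d u v ≤ d u w + p → d w v ≤ p
  ball-∩-between {w} {x} {u} {v} {p} xwu xv≤p uv≤uw+p with d-four-point v w x u
  ... | inj₁ le = +-cancelʳ-≤ (d w u) (d w v) p (begin
    d w v + d w u           ≤⟨ +-monoʳ-≤ (d w v) (m≤n+m (d w u) (d x w)) ⟩
    d w v + (d x w + d w u) ≡⟨ cong₂ _+_ (d-sym w v) (sym xwu) ⟩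
    d v w + d x u           ≤⟨ le ⟩
    d v x + d w u           ≤⟨ +-monoˡ-≤ (d w u) (subst (_≤ p) (d-sym x v) xv≤p) ⟩
    p + d w u               ∎)
    where open ≤-Reasoning
  ... | inj₂ le = +-cancelʳ-≤ (d x u) (d w v) p (begin
    d w v + d x u           ≡⟨ cong (_+ d x u) (d-sym w v) ⟩
    d v w + d x u           ≤⟨ le ⟩
    d v u + d w x           ≤⟨ +-monoˡ-≤ (d w x) (subst (_≤ d u w + p) (d-sym u v) uv≤uw+p) ⟩
    (d u w + p) + d w x     ≡⟨ cong₂ (λ s t → (s + p) + t) (d-sym u w) (d-sym w x) ⟩
    (d w u + p) + d x w     ≡⟨ shuffle (d w u) p (d x w) ⟩
    p + (d x w + d w u)     ≡⟨ cong (p +_) (sym xwu) ⟩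
    p + d x u               ∎)
    where
    open ≤-Reasoning
    shuffle : ∀ a p b → (a + p) + b ≡ p + (b + a)
    shuffle = solve-∀

-- Opened only from here on: an unqualified +_ makes ℕ sections such as (n +_) ambiguous.
open import Data.Integer using (+_)

∣i-[i+n]∣≡n : ∀ i n → ∣ i ℤ.- (i ℤ.+ + n) ∣ ≡ n
∣i-[i+n]∣≡n i n = trans (cong ∣_∣ (i-[i+j]≡-j i (+ n))) (ℤ.∣-i∣≡∣i∣ (+ n))
  where
  i-[i+j]≡-j : ∀ i j → i ℤ.- (i ℤ.+ j) ≡ ℤ.- j
  i-[i+j]≡-j = ℤ-Solver.solve-∀

∣[i+n]-i∣≡n : ∀ i n → ∣ (i ℤ.+ + n) ℤ.- i ∣ ≡ n
∣[i+n]-i∣≡n i n = trans (ℤ.∣i-j∣≡∣j-i∣ (i ℤ.+ + n) i) (∣i-[i+n]∣≡n i n)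

∣+m-+n∣≡n∸m : ∀ {m n} → m ≤ n → ∣ + m ℤ.- + n ∣ ≡ n ∸ m
∣+m-+n∣≡n∸m {m} {n} m≤n =
  trans (cong (λ k → ∣ + m ℤ.- + k ∣) (sym (m+[n∸m]≡n m≤n))) (∣i-[i+n]∣≡n (+ m) (n ∸ m))

i≤j⇒j≡i+n : ∀ {i j n} → i ≤ℤ j → ∣ i ℤ.- j ∣ ≡ n → j ≡ i ℤ.+ + n
i≤j⇒j≡i+n {i} {j} i≤j refl = trans (sym (i+[j-i]≡j i j)) (cong (λ k → i ℤ.+ k) (sym (ℤ.∣-∣-≤ i≤j)))
  where
  i+[j-i]≡j : ∀ i j → i ℤ.+ (j ℤ.- i) ≡ j
  i+[j-i]≡j = ℤ-Solver.solve-∀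

infix 4 _≤ᴱ_

_≤ᴱ_ : ℕ → Ext → Set
n ≤ᴱ fin m = n ≤ m
n ≤ᴱ inf   = ⊤

≤-≤ᴱ-trans : ∀ B {m n} → m ≤ n → n ≤ᴱ B → m ≤ᴱ B
≤-≤ᴱ-trans (fin _) m≤n n≤B = ≤-trans m≤n n≤B
≤-≤ᴱ-trans inf     _   _   = tt

minE≤ : ∀ B k → minE B k ≤ k
minE≤ (fin n) k = m⊓n≤n n k
minE≤ inf     k = ≤-refl

≤minE⇒≤ᴱ : ∀ B {n k} → n ≤ minE B k → n ≤ᴱ B
≤minE⇒≤ᴱ (fin m) {n} {k} n≤min = ≤-trans n≤min (m⊓n≤m m k)
≤minE⇒≤ᴱ inf     _             = tt

≤ᴱ∧≤⇒≤minE : ∀ B {n k} → n ≤ᴱ B → n ≤ k → n ≤ minE B k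
≤ᴱ∧≤⇒≤minE (fin _) n≤B n≤k = ⊓-glb n≤B n≤k
≤ᴱ∧≤⇒≤minE inf     _   n≤k = n≤k

minE-LeftOK : ∀ A k {i} → LeftOK (fin (minE A k)) i → LeftOK A i
minE-LeftOK (fin m) k -min≤i = ℤ.≤-trans (ℤ.neg-mono-≤ (ℤ.+≤+ (m⊓n≤m m k))) -min≤i
minE-LeftOK inf     k _      = tt

minE-RightOK : ∀ e B k {i} → RightOK (fin (e + minE B k)) i → RightOK (e +ᴱ B) i
minE-RightOK e (fin n) k i≤e+min = ℤ.≤-trans i≤e+min (ℤ.+≤+ (+-monoʳ-≤ e (m⊓n≤m n k)))
minE-RightOK e inf     k _       = tt

data Segment (e : ℕ) (A B : Ext) : ℤ → Set where
  leftRay  : ∀ {n} → n ≤ᴱ A → Segment e A B (ℤ.- + n)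
  middle   : ∀ {m} → m ≤ e  → Segment e A B (+ m)
  rightRay : ∀ {n} → n ≤ᴱ B → Segment e A B (+ (e + n))

module _ {e : ℕ} {A B : Ext} where

  segment : ∀ {i} → LeftOK A i → RightOK (e +ᴱ B) i → Segment e A B i
  segment { -[1+ n ]} left-ok _ = leftRay (bound A left-ok)
    where
    bound : ∀ A → LeftOK A -[1+ n ] → suc n ≤ᴱ A
    bound (fin m) -m≤-1-n = ℤ.drop‿+≤+ (ℤ.neg-cancel-≤ -m≤-1-n)
    bound inf     _       = tt
  segment {+ m} _ right-ok with m ≤? e
  ... | yes m≤e = middle m≤e
  ... | no  m≰e = subst (λ k → Segment e A B (+ k)) (m+[n∸m]≡n e≤m) (rightRay (bound B right-ok))
    where
    e≤m : e ≤ m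
    e≤m = <⇒≤ (≰⇒> m≰e)
    bound : ∀ B → RightOK (e +ᴱ B) (+ m) → m ∸ e ≤ᴱ B
    bound (fin n) m≤e+n = m≤n+o⇒m∸n≤o m e (ℤ.drop‿+≤+ m≤e+n)
    bound inf     _     = tt

  segment-bounds : ∀ {i} → Segment e A B i → LeftOK A i × RightOK (e +ᴱ B) i
  segment-bounds (leftRay {n} n≤A) = left-ok A n≤A , nonneg-right B
    where
    left-ok : ∀ A → n ≤ᴱ A → LeftOK A (ℤ.- + n)
    left-ok (fin m) n≤m = ℤ.neg-mono-≤ (ℤ.+≤+ n≤m)
    left-ok inf     _   = tt
    nonneg-right : ∀ B → RightOK (e +ᴱ B) (ℤ.- + n)
    nonneg-right (fin _) = ℤ.neg-≤-pos
    nonneg-right inf     = tt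
  segment-bounds (middle {m} m≤e) = nonneg-left A , right-ok B
    where
    right-ok : ∀ B → RightOK (e +ᴱ B) (+ m)
    right-ok (fin n) = ℤ.+≤+ (≤-trans m≤e (m≤m+n e n))
    right-ok inf     = tt
    nonneg-left : ∀ A → LeftOK A (+ m)
    nonneg-left (fin _) = ℤ.neg-≤-pos
    nonneg-left inf     = tt
  segment-bounds (rightRay {n} n≤B) = nonneg-left A , right-ok B n≤B
    where
    right-ok : ∀ B → n ≤ᴱ B → RightOK (e +ᴱ B) (+ (e + n))
    right-ok (fin b) n≤b = ℤ.+≤+ (+-monoʳ-≤ e n≤b)
    right-ok inf     _   = tt
    nonneg-left : ∀ A → LeftOK A (+ (e + n))
    nonneg-left (fin _) = ℤ.neg-≤-pos
    nonneg-left inf     = tt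

Segment⇒InDom : ∀ {q e A B i} (P : Path q) → left P ≡ A → right P ≡ e +ᴱ B → Segment e A B i → InDom P i
Segment⇒InDom P refl refl = segment-bounds

InDom⇒Segment : ∀ {q e A B i} (P : Path q) → left P ≡ A → right P ≡ e +ᴱ B → InDom P i → Segment e A B i
InDom⇒Segment P refl refl (l , r) = segment l r

subpath : ∀ {q} (P : Path q) (l r : Ext) →
          (∀ {i} → LeftOK l i → LeftOK (left P) i) → (∀ {i} → RightOK r i → RightOK (right P) i) → Path q
subpath P l r l⊆ r⊆ = record
  { γ        = γ P
  ; left     = l
  ; right    = r
  ; geodesic = λ i j li ri lj rj → geodesic P i j (l⊆ li) (r⊆ ri) (l⊆ lj) (r⊆ rj)
  }

InDom-convex : ∀ {q} (P : Path q) {i k s} → InDom P i → InDom P k → i ≤ℤ s → s ≤ℤ k → InDom P s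
InDom-convex P (li , _) (_ , rk) i≤s s≤k = left-convex (left P) li i≤s , right-convex (right P) rk s≤k
  where
  left-convex : ∀ A {i s} → LeftOK A i → i ≤ℤ s → LeftOK A s
  left-convex (fin _) -A≤i i≤s = ℤ.≤-trans -A≤i i≤s
  left-convex inf     _    _   = tt
  right-convex : ∀ B {k s} → RightOK B k → s ≤ℤ k → RightOK B s
  right-convex (fin _) k≤B s≤k = ℤ.≤-trans s≤k k≤B
  right-convex inf     _   _   = tt

step-toward : ∀ {q} (P : Path q) {t j m} → InDom P t → InDom P j → ∣ t ℤ.- j ∣ ≡ suc m →
              Σ ℤ λ s → InDom P s × ∣ s ℤ.- t ∣ ≡ 1 × ∣ s ℤ.- j ∣ ≡ m
step-toward P {t} {j} {m} dt dj ∣t-j∣≡1+m with ℤ.≤-total t j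
... | inj₁ t≤j = s , InDom-convex P dt dj (ℤ.i≤i+j t (+ 1)) s≤j , ∣[i+n]-i∣≡n t 1 ,
                 trans (cong (λ k → ∣ s ℤ.- k ∣) j≡s+m) (∣i-[i+n]∣≡n s m)
  where
  s = t ℤ.+ + 1
  j≡s+m : j ≡ s ℤ.+ + m
  j≡s+m = trans (i≤j⇒j≡i+n t≤j ∣t-j∣≡1+m) (sym (ℤ.+-assoc t (+ 1) (+ m)))
  s≤j : s ≤ℤ j
  s≤j = subst (s ≤ℤ_) (sym j≡s+m) (ℤ.i≤i+j s (+ m))
... | inj₂ j≤t = s , InDom-convex P dj dt (ℤ.i≤i+j j (+ m)) s≤t ,
                 trans (cong (λ k → ∣ s ℤ.- k ∣) t≡s+1) (∣i-[i+n]∣≡n s 1) , ∣[i+n]-i∣≡n j m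
  where
  s = j ℤ.+ + m
  t≡s+1 : t ≡ s ℤ.+ + 1
  t≡s+1 = trans (i≤j⇒j≡i+n j≤t (trans (ℤ.∣i-j∣≡∣j-i∣ j t) ∣t-j∣≡1+m))
                (trans (cong (λ k → j ℤ.+ + k) (+-comm 1 m)) (sym (ℤ.+-assoc j (+ m) (+ 1))))
  s≤t : s ≤ℤ t
  s≤t = subst (s ≤ℤ_) (sym t≡s+1) (ℤ.i≤i+j s (+ 1))

module PathsInTree (q : ℕ) where

  open ReducedWordTree q public
  open TreeGeometry d d-sym d≡0⇒≡ d-triangle d-four-point d-parity public

  geodesic-d : (P : Path q) {i j : ℤ} → InDom P i → InDom P j → d (γ P i) (γ P j) ≡ ∣ i ℤ.- j ∣
  geodesic-d P {i} {j} (li , ri) (lj , rj) = sym (Dist⇒≡d (geodesic P i j li ri lj rj))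

  γ-injective : (P : Path q) {i j : ℤ} → InDom P i → InDom P j → γ P i ≡ γ P j → i ≡ j
  γ-injective P {i} {j} di dj γi≡γj = ℤ.i-j≡0⇒i≡j i j (ℤ.∣i∣≡0⇒i≡0
    (trans (sym (geodesic-d P di dj)) (trans (cong (d (γ P i)) (sym γi≡γj)) (d-refl (γ P i)))))

  -- The step from γ t towards γ j stays on P, so a neighbour g of γ t off P cannot be that step.
  leave-path : (P : Path q) {t j : ℤ} {g : Vertex q} → InDom P t → InDom P j → d (γ P t) g ≡ 1 →
               (∀ s → InDom P s → g ≢ γ P s) → d g (γ P j) ≡ suc (d (γ P t) (γ P j))
  leave-path P {t} {j} {g} dt dj yg≡1 g∉P = step-away yg≡1 not-toward
    where
    not-toward : suc (d g (γ P j)) ≢ d (γ P t) (γ P j)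
    not-toward toward with step-toward P dt dj (trans (sym (geodesic-d P dt dj)) (sym toward))
    ... | s , ds , ∣s-t∣≡1 , ∣s-j∣≡gu = g∉P s ds (between-unique
            (trans (d-sym g (γ P t)) yg≡1) refl
            (trans (geodesic-d P ds dt) ∣s-t∣≡1) (trans (geodesic-d P ds dj) ∣s-j∣≡gu)
            (sym toward))

  ray-leaving : (P : Path q) (r : ℕ → Vertex q) (B : Ext) →
    (∀ {m n} → m ≤ n → n ≤ᴱ B → d (r m) (r n) ≡ n ∸ m) →
    ∀ {t} → InDom P t → r 0 ≡ γ P t → (1 ≤ᴱ B → ∀ s → InDom P s → r 1 ≢ γ P s) →
    ∀ {n j} → n ≤ᴱ B → InDom P j → d (r n) (γ P j) ≡ n + d (r 0) (γ P j)
  ray-leaving P r B r-geodesic dt r0≡γt r1∉P {zero}  _   _  = refl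
  ray-leaving P r B r-geodesic {t} dt r0≡γt r1∉P {suc m} {j} n≤B dj =
    trans (extend-geodesic {r (suc m)} {r 0} {r 1} {u} r0r1≡1 rnr0≡1+rnr1 r1u≡1+r0u)
          (cong (_+ d (r 0) u) (trans (d-sym (r (suc m)) (r 0)) (r-geodesic z≤n n≤B)))
    where
    u = γ P j
    1≤B : 1 ≤ᴱ B
    1≤B = ≤-≤ᴱ-trans B (s≤s z≤n) n≤B
    r0r1≡1 : d (r 0) (r 1) ≡ 1
    r0r1≡1 = r-geodesic z≤n 1≤B
    rnr0≡1+rnr1 : d (r (suc m)) (r 0) ≡ suc (d (r (suc m)) (r 1))
    rnr0≡1+rnr1 = begin
      d (r (suc m)) (r 0)       ≡⟨ d-sym (r (suc m)) (r 0) ⟩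
      d (r 0) (r (suc m))       ≡⟨ r-geodesic z≤n n≤B ⟩
      suc m                     ≡⟨ cong suc (r-geodesic (s≤s z≤n) n≤B) ⟨
      suc (d (r 1) (r (suc m))) ≡⟨ cong suc (d-sym (r 1) (r (suc m))) ⟩
      suc (d (r (suc m)) (r 1)) ∎
      where open ≡-Reasoning
    r1u≡1+r0u : d (r 1) u ≡ suc (d (r 0) u)
    r1u≡1+r0u = subst (λ y → d (r 1) u ≡ suc (d y u)) (sym r0≡γt)
      (leave-path P dt dj (subst (λ y → d y (r 1) ≡ 1) r0≡γt r0r1≡1) (r1∉P 1≤B))

module ThickIntersection (q : ℕ) (T₁ T₂ : Path q) (e : ℕ) (a b : Ext)
  (left₁ : left T₁ ≡ a) (right₁ : right T₁ ≡ e +ᴱ b)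
  (middle∈T₂ : ∀ {m} → m ≤ e → InDom T₂ (+ m))
  (agree : ∀ {m} → m ≤ e → γ T₁ (+ m) ≡ γ T₂ (+ m))
  (meet-middle : ∀ {i j} → InDom T₁ i → InDom T₂ j → γ T₁ i ≡ γ T₂ j → (+ 0 ≤ℤ i) × (i ≤ℤ + e))
  (p₁ p₂ : ℕ) (p₁≤p₂ : p₁ ≤ p₂) where

  open PathsInTree q

  k : ℕ
  k = p₂ ∸ p₁

  dom₁ : ∀ {i} → Segment e a b i → InDom T₁ i
  dom₁ = Segment⇒InDom T₁ left₁ right₁

  leftRay₁ rightRay₁ : ℕ → Vertex q
  leftRay₁  n = γ T₁ (ℤ.- + n)
  rightRay₁ n = γ T₁ (+ (e + n))

  leftRay₁-geodesic : ∀ {m n} → m ≤ n → n ≤ᴱ a → d (leftRay₁ m) (leftRay₁ n) ≡ n ∸ m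
  leftRay₁-geodesic {m} {n} m≤n n≤a = begin
    d (leftRay₁ m) (leftRay₁ n)   ≡⟨ geodesic-d T₁ (dom₁ (leftRay (≤-≤ᴱ-trans a m≤n n≤a))) (dom₁ (leftRay n≤a)) ⟩
    ∣ ℤ.- + m ℤ.- ℤ.- + n ∣       ≡⟨ cong ∣_∣ (-i+j≡j-i (+ m) (+ n)) ⟩
    ∣ + n ℤ.- + m ∣               ≡⟨ ℤ.∣i-j∣≡∣j-i∣ (+ n) (+ m) ⟩
    ∣ + m ℤ.- + n ∣               ≡⟨ ∣+m-+n∣≡n∸m m≤n ⟩
    n ∸ m                         ∎
    where
    open ≡-Reasoning
    -i+j≡j-i : ∀ i j → ℤ.- i ℤ.- ℤ.- j ≡ j ℤ.- i
    -i+j≡j-i = ℤ-Solver.solve-∀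

  rightRay₁-geodesic : ∀ {m n} → m ≤ n → n ≤ᴱ b → d (rightRay₁ m) (rightRay₁ n) ≡ n ∸ m
  rightRay₁-geodesic {m} {n} m≤n n≤b = begin
    d (rightRay₁ m) (rightRay₁ n) ≡⟨ geodesic-d T₁ (dom₁ (rightRay (≤-≤ᴱ-trans b m≤n n≤b))) (dom₁ (rightRay n≤b)) ⟩
    ∣ + (e + m) ℤ.- + (e + n) ∣   ≡⟨ ∣+m-+n∣≡n∸m (+-monoʳ-≤ e m≤n) ⟩
    (e + n) ∸ (e + m)             ≡⟨ [m+n]∸[m+o]≡n∸o e n m ⟩
    n ∸ m                         ∎
    where open ≡-Reasoning

  leftRay₁-leaves : 1 ≤ᴱ a → ∀ j → InDom T₂ j → leftRay₁ 1 ≢ γ T₂ j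
  leftRay₁-leaves 1≤a j dj on-T₂ with meet-middle (dom₁ (leftRay 1≤a)) dj on-T₂
  ... | () , _

  rightRay₁-leaves : 1 ≤ᴱ b → ∀ j → InDom T₂ j → rightRay₁ 1 ≢ γ T₂ j
  rightRay₁-leaves 1≤b j dj on-T₂ = m+1+n≰m e (ℤ.drop‿+≤+ (proj₂ (meet-middle (dom₁ (rightRay 1≤b)) dj on-T₂)))

  module Ray (r : ℕ → Vertex q) (B : Ext)
    (r-geodesic : ∀ {m n} → m ≤ n → n ≤ᴱ B → d (r m) (r n) ≡ n ∸ m)
    {t : ℤ} (dt : InDom T₂ t) (r0≡γt : r 0 ≡ γ T₂ t)
    (r-leaves : 1 ≤ᴱ B → ∀ s → InDom T₂ s → r 1 ≢ γ T₂ s) where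

    ray-in : ∀ {n v} → n ≤ᴱ B → n ≤ k → d (r n) v ≤ p₁ → d (γ T₂ t) v ≤ p₂
    ray-in {n} {v} n≤B n≤k rv≤p₁ = subst (λ y → d y v ≤ p₂) r0≡γt (begin
      d (r 0) v              ≤⟨ d-triangle (r 0) (r n) v ⟩
      d (r 0) (r n) + d (r n) v ≡⟨ cong (_+ d (r n) v) (r-geodesic z≤n n≤B) ⟩
      n + d (r n) v          ≤⟨ +-mono-≤ n≤k rv≤p₁ ⟩
      k + p₁                 ≡⟨ m∸n+n≡m p₁≤p₂ ⟩
      p₂                     ∎)
      where open ≤-Reasoning

    -- r k lies between r n and every vertex u of T₂, which is at distance at least k from r k.
    ray-out : ∀ {n v j} → n ≤ᴱ B → k ≤ n → InDom T₂ j → d (r n) v ≤ p₁ → d (γ T₂ j) v ≤ p₂ → d (r k) v ≤ p₁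
    ray-out {n} {v} {j} n≤B k≤n dj rv≤p₁ uv≤p₂ = ball-∩-between between rv≤p₁ (begin
      d u v                   ≤⟨ uv≤p₂ ⟩
      p₂                      ≡⟨ m∸n+n≡m p₁≤p₂ ⟨
      k + p₁                  ≤⟨ +-monoˡ-≤ p₁ (m≤m+n k Y) ⟩
      (k + Y) + p₁            ≡⟨ cong (_+ p₁) (trans (sym (distance k≤B)) (d-sym (r k) u)) ⟩
      d u (r k) + p₁          ∎)
      where
      open ≤-Reasoning
      u = γ T₂ j
      Y = d (r 0) u
      k≤B : k ≤ᴱ B
      k≤B = ≤-≤ᴱ-trans B k≤n n≤B
      distance : ∀ {m} → m ≤ᴱ B → d (r m) u ≡ m + Y
      distance m≤B = ray-leaving T₂ r B r-geodesic dt r0≡γt r-leaves m≤B dj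
      between : d (r n) u ≡ d (r n) (r k) + d (r k) u
      between = begin-equality
        d (r n) u             ≡⟨ distance n≤B ⟩
        n + Y                 ≡⟨ cong (_+ Y) (m∸n+n≡m k≤n) ⟨
        (n ∸ k) + k + Y       ≡⟨ +-assoc (n ∸ k) k Y ⟩
        (n ∸ k) + (k + Y)     ≡⟨ cong₂ _+_ (trans (sym (r-geodesic k≤n n≤B)) (d-sym (r k) (r n))) (sym (distance k≤B)) ⟩
        d (r n) (r k) + d (r k) u ∎

  module Left  = Ray leftRay₁  a leftRay₁-geodesic  (middle∈T₂ z≤n) (agree z≤n) leftRay₁-leaves
  module Right = Ray rightRay₁ b rightRay₁-geodesic (middle∈T₂ ≤-refl)
                     (trans (cong (λ n → γ T₁ (+ n)) (+-identityʳ e)) (agree ≤-refl)) rightRay₁-leaves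

  T₃ : Path q
  T₃ = subpath T₁ (fin (minE a k)) (fin (e + minE b k))
         (subst (λ A → LeftOK A _) (sym left₁) ∘ minE-LeftOK a k)
         (subst (λ B → RightOK B _) (sym right₁) ∘ minE-RightOK e b k)

  dom₃ : ∀ {i} → Segment e (fin (minE a k)) (fin (minE b k)) i → InDom T₃ i
  dom₃ = segment-bounds

  length-T₃ : length T₃ ≡ fin (e + minE a k + minE b k)
  length-T₃ = cong fin (trans (sym (+-assoc (minE a k) e (minE b k))) (cong (_+ minE b k) (+-comm (minE a k) e)))

  ∩⊆T₃ : ∀ v → Thick T₁ p₁ v × Thick T₂ p₂ v → Thick T₃ p₁ v
  ∩⊆T₃ v ((i , di , v∈B₁) , (j , dj , v∈B₂)) with InDom⇒Segment T₁ left₁ right₁ di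
  ... | leftRay {n} n≤a with n ≤? k
  ...   | yes n≤k = ℤ.- + n , dom₃ (leftRay (≤ᴱ∧≤⇒≤minE a n≤a n≤k)) , v∈B₁
  ...   | no  n≰k = ℤ.- + k , dom₃ (leftRay (≤ᴱ∧≤⇒≤minE a k≤a ≤-refl)) ,
                    d≤⇒InBall (Left.ray-out n≤a k≤n dj (InBall⇒d≤ v∈B₁) (InBall⇒d≤ v∈B₂))
    where
    k≤n = <⇒≤ (≰⇒> n≰k)
    k≤a = ≤-≤ᴱ-trans a k≤n n≤a
  ∩⊆T₃ v ((i , di , v∈B₁) , _) | middle m≤e = i , dom₃ (middle m≤e) , v∈B₁
  ∩⊆T₃ v ((i , di , v∈B₁) , (j , dj , v∈B₂)) | rightRay {n} n≤b with n ≤? k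
  ...   | yes n≤k = + (e + n) , dom₃ (rightRay (≤ᴱ∧≤⇒≤minE b n≤b n≤k)) , v∈B₁
  ...   | no  n≰k = + (e + k) , dom₃ (rightRay (≤ᴱ∧≤⇒≤minE b k≤b ≤-refl)) ,
                    d≤⇒InBall (Right.ray-out n≤b k≤n dj (InBall⇒d≤ v∈B₁) (InBall⇒d≤ v∈B₂))
    where
    k≤n = <⇒≤ (≰⇒> n≰k)
    k≤b = ≤-≤ᴱ-trans b k≤n n≤b

  T₃⊆∩ : ∀ v → Thick T₃ p₁ v → Thick T₁ p₁ v × Thick T₂ p₂ v
  T₃⊆∩ v (i , di , v∈B₁) with segment {e} {fin (minE a k)} {fin (minE b k)} (proj₁ di) (proj₂ di)
  ... | leftRay {n} n≤min =
        (i , dom₁ (leftRay (≤minE⇒≤ᴱ a n≤min)) , v∈B₁) ,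
        (+ 0 , middle∈T₂ z≤n ,
         d≤⇒InBall (Left.ray-in (≤minE⇒≤ᴱ a n≤min) (≤-trans n≤min (minE≤ a k)) (InBall⇒d≤ v∈B₁)))
  ... | middle {m} m≤e =
        (i , dom₁ (middle m≤e) , v∈B₁) ,
        (i , middle∈T₂ m≤e , d≤⇒InBall (subst (λ x → d x v ≤ p₂) (agree m≤e) (≤-trans (InBall⇒d≤ v∈B₁) p₁≤p₂)))
  ... | rightRay {n} n≤min =
        (i , dom₁ (rightRay (≤minE⇒≤ᴱ b n≤min)) , v∈B₁) ,
        (+ e , middle∈T₂ ≤-refl ,
         d≤⇒InBall (Right.ray-in (≤minE⇒≤ᴱ b n≤min) (≤-trans n≤min (minE≤ b k)) (InBall⇒d≤ v∈B₁)))

  thick-∩ : IsThickLine (λ v → Thick T₁ p₁ v × Thick T₂ p₂ v) p₁ (fin (e + minE a k + minE b k))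
  thick-∩ = T₃ , length-T₃ , λ v → mk⇔ (∩⊆T₃ v) (T₃⊆∩ v)

module CommonStem (q : ℕ) (T₁ T₂ : Path q) (e : ℕ) (a₁ b₁ a₂ b₂ : Ext)
  (left₁ : left T₁ ≡ a₁) (right₁ : right T₁ ≡ e +ᴱ b₁) (left₂ : left T₂ ≡ a₂) (right₂ : right T₂ ≡ e +ᴱ b₂)
  (y₁≡y₂ : γ T₁ (+ 0) ≡ γ T₂ (+ 0)) (z₁≡z₂ : γ T₁ (+ e) ≡ γ T₂ (+ e))
  (stem-∩ : ∀ v → (OnPath T₁ v × OnPath T₂ v) ⇔ (Σ ℤ λ i → ((+ 0 ≤ℤ i) × (i ≤ℤ + e)) × γ T₁ i ≡ v)) where

  open PathsInTree q

  middle∈T₁ : ∀ {m} → m ≤ e → InDom T₁ (+ m)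
  middle∈T₁ m≤e = Segment⇒InDom T₁ left₁ right₁ (middle m≤e)

  middle∈T₂ : ∀ {m} → m ≤ e → InDom T₂ (+ m)
  middle∈T₂ m≤e = Segment⇒InDom T₂ left₂ right₂ (middle m≤e)

  d-middle : ∀ (P : Path q) {m n} → InDom P (+ m) → InDom P (+ n) → m ≤ n → d (γ P (+ n)) (γ P (+ m)) ≡ n ∸ m
  d-middle P {m} {n} dm dn m≤n = trans (geodesic-d P dn dm) (trans (ℤ.∣i-j∣≡∣j-i∣ (+ n) (+ m)) (∣+m-+n∣≡n∸m m≤n))

  -- Both γ T₁ m and γ T₂ m lie between y and z at distance m from y.
  agree : ∀ {m} → m ≤ e → γ T₁ (+ m) ≡ γ T₂ (+ m)
  agree {m} m≤e = between-unique
    (d-middle T₁ (middle∈T₁ z≤n) (middle∈T₁ m≤e) z≤n)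
    (trans (d-sym _ _) (d-middle T₁ (middle∈T₁ m≤e) (middle∈T₁ ≤-refl) m≤e))
    (subst (λ y → d _ y ≡ m) (sym y₁≡y₂) (d-middle T₂ (middle∈T₂ z≤n) (middle∈T₂ m≤e) z≤n))
    (subst (λ z → d _ z ≡ e ∸ m) (sym z₁≡z₂) (trans (d-sym _ _) (d-middle T₂ (middle∈T₂ m≤e) (middle∈T₂ ≤-refl) m≤e)))
    (trans (d-sym _ _) (trans (d-middle T₁ (middle∈T₁ z≤n) (middle∈T₁ ≤-refl) z≤n) (sym (m+[n∸m]≡n m≤e))))

  meet-index : ∀ {i j} → InDom T₁ i → InDom T₂ j → γ T₁ i ≡ γ T₂ j → Σ ℕ λ m → m ≤ e × i ≡ + m × j ≡ + m
  meet-index {i} {j} di dj γi≡γj with Equivalence.to (stem-∩ (γ T₁ i)) ((i , di , refl) , (j , dj , sym γi≡γj))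
  ... | + m , (_ , m≤e) , γm≡γi = m , ℤ.drop‿+≤+ m≤e ,
          γ-injective T₁ di (middle∈T₁ (ℤ.drop‿+≤+ m≤e)) (sym γm≡γi) ,
          γ-injective T₂ dj (middle∈T₂ (ℤ.drop‿+≤+ m≤e)) (trans (sym γi≡γj) (trans (sym γm≡γi) (agree (ℤ.drop‿+≤+ m≤e))))
  ... | -[1+ _ ] , (() , _) , _

  meet-middle₁ : ∀ {i j} → InDom T₁ i → InDom T₂ j → γ T₁ i ≡ γ T₂ j → (+ 0 ≤ℤ i) × (i ≤ℤ + e)
  meet-middle₁ di dj γi≡γj with meet-index di dj γi≡γj
  ... | m , m≤e , refl , _ = ℤ.+≤+ z≤n , ℤ.+≤+ m≤e

  meet-middle₂ : ∀ {j i} → InDom T₂ j → InDom T₁ i → γ T₂ j ≡ γ T₁ i → (+ 0 ≤ℤ j) × (j ≤ℤ + e)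
  meet-middle₂ dj di γj≡γi with meet-index di dj (sym γj≡γi)
  ... | m , m≤e , _ , refl = ℤ.+≤+ z≤n , ℤ.+≤+ m≤e

IsThickLine-⇔ : ∀ {q} {S S′ : Vertex q → Set} {p l} → (∀ v → S′ v ⇔ S v) → IsThickLine S p l → IsThickLine S′ p l
IsThickLine-⇔ S′⇔S (T , length≡ , S⇔T) = T , length≡ , λ v → ⇔.trans (S′⇔S v) (S⇔T v)

proposition2p2 : (q : ℕ) → IsPrimePower q →
    (T₁ T₂ : Path q) (p₁ p₂ e : ℕ) (a b c d : Ext) (y z : Vertex q) →
    left T₁ ≡ a → right T₁ ≡ e +ᴱ b →
    left T₂ ≡ c → right T₂ ≡ e +ᴱ d →
    γ T₁ (+ 0) ≡ y → γ T₁ (+ e) ≡ z →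
    γ T₂ (+ 0) ≡ y → γ T₂ (+ e) ≡ z →
    (∀ v → (OnPath T₁ v × OnPath T₂ v) ⇔
           (Σ ℤ λ i → ((+ 0 ≤ℤ i) × (i ≤ℤ + e)) × γ T₁ i ≡ v)) →
    (p₁ ≤ p₂ →
       IsThickLine (λ v → Thick T₁ p₁ v × Thick T₂ p₂ v) (p₁ ⊓ p₂)
         (fin (e + minE a (p₂ ∸ p₁) + minE b (p₂ ∸ p₁))))
    × (p₂ ≤ p₁ →
       IsThickLine (λ v → Thick T₁ p₁ v × Thick T₂ p₂ v) (p₁ ⊓ p₂)
         (fin (e + minE c (p₁ ∸ p₂) + minE d (p₁ ∸ p₂))))
proposition2p2 q _ T₁ T₂ p₁ p₂ e a b c d y z left₁ right₁ left₂ right₂ y₁ z₁ y₂ z₂ stem-∩ =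
  p₁≤p₂⇒thick , p₂≤p₁⇒thick
  where
  open CommonStem q T₁ T₂ e a b c d left₁ right₁ left₂ right₂ (trans y₁ (sym y₂)) (trans z₁ (sym z₂)) stem-∩
  S₁₂ : Vertex q → Set
  S₁₂ v = Thick T₁ p₁ v × Thick T₂ p₂ v

  l₁ l₂ : Len
  l₁ = fin (e + minE a (p₂ ∸ p₁) + minE b (p₂ ∸ p₁))
  l₂ = fin (e + minE c (p₁ ∸ p₂) + minE d (p₁ ∸ p₂))

  p₁≤p₂⇒thick : p₁ ≤ p₂ → IsThickLine S₁₂ (p₁ ⊓ p₂) l₁
  p₁≤p₂⇒thick p₁≤p₂ = subst (λ p → IsThickLine S₁₂ p l₁) (sym (m≤n⇒m⊓n≡m p₁≤p₂))
    (ThickIntersection.thick-∩ q T₁ T₂ e a b left₁ right₁ middle∈T₂ agree meet-middle₁ p₁ p₂ p₁≤p₂)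

  p₂≤p₁⇒thick : p₂ ≤ p₁ → IsThickLine S₁₂ (p₁ ⊓ p₂) l₂
  p₂≤p₁⇒thick p₂≤p₁ = subst (λ p → IsThickLine S₁₂ p l₂) (sym (m≥n⇒m⊓n≡n p₂≤p₁))
    (IsThickLine-⇔ (λ _ → mk⇔ ×-swap ×-swap)
      (ThickIntersection.thick-∩ q T₂ T₁ e c d left₂ right₂ middle∈T₁ (sym ∘ agree) meet-middle₂ p₂ p₁ p₂≤p₁))
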